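{- Let $n,m\ge 1$ be integers and let $C=(c_{ij})$ be an $n\times m$ matrix with entries in $\{0,-1\}$ such that (i) every entry of the first row of $C$ equals $-1$, and (ii) $C$ is a Ferrers matrix: whenever $c_{ij}=-1$, also $c_{i'j'}=-1$ for all $i'\le i$ and $j'\le j$. Let $a_2,\dots,a_n$ and $b_2,\dots,b_m$ be numbers with $a_2\ge a_3\ge\dots\ge a_n$ and $b_2\ge\dots\ge b_m$. Let $M$ be the square matrix of order $n+m-1$ with block form $$M=\begin{pmatrix} A & C\\ B & D\end{pmatrix},$$ where: $A$ is the $n\times(n-1)$ matrix whose first row is zero and whose $i$-th row ($2\le i\le n$) has the single nonzero entry $a_i$ in column $i-1$; $B$ is the $(m-1)\times(n-1)$ matrix with $B_{j-1,\,i-1}=c_{ij}$ for $2\le i\le n$, $2\le j\le m$ (i.e. $B$ is the transpose of $C$ with its first row and first column deleted); $D$ is the $(m-1)\times m$ matrix whose first column is zero and whose $(j-1)$-th row ($2\le j\le m$) has the single nonzero entry $b_j$ in column $j$. Assume that the sum of the entries of each of the rows $2,\dots,n$ of $M$ is zero, and that the sum of the entries of each of the last $m-1$ columns of $M$ is zero. Then $$\det M=(-1)^n\prod_{i=2}^n a_i\prod_{j=2}^m b_j .$$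
   Context: The zero-sum conditions mean $a_i=-\sum_{j=1}^m c_{ij}$ for $2\le i\le n$ and $b_j=-\sum_{i=1}^n c_{ij}$ for $2\le j\le m$, i.e. $a_i$ is the number of $-1$'s in row $i$ of $C$ and $b_j$ is the number of $-1$'s in column $j$ of $C$. Empty products equal $1$. -}

module Defs where

open import Data.Nat as ℕ using (ℕ; zero; suc)
open import Data.Nat.Properties using (+-suc)
open import Data.Integer using (ℤ; 0ℤ; 1ℤ; -1ℤ; _+_; _*_; _^_)
open import Data.Fin using (Fin; zero; suc; toℕ; punchIn; splitAt; cast; _≟_)
open import Data.Sum using (_⊎_; inj₁; inj₂)
open import Relation.Nullary using (yes; no)
open import Relation.Binary.PropositionalEquality using (sym)

Σ : (k : ℕ) → (Fin k → ℤ) → ℤ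
Σ zero    f = 0ℤ
Σ (suc k) f = f zero + Σ k (λ i → f (suc i))

Π : (k : ℕ) → (Fin k → ℤ) → ℤ
Π zero    f = 1ℤ
Π (suc k) f = f zero * Π k (λ i → f (suc i))

Mat : ℕ → Set
Mat k = Fin k → Fin k → ℤ

det : (k : ℕ) → Mat k → ℤ
det zero    M = 1ℤ
det (suc k) M =
  Σ (suc k) (λ j → (-1ℤ ^ toℕ j) * (M zero j * det k (λ r c → M (suc r) (punchIn j c))))

-- Indexing conventions: n = suc n', m = suc m'.
--  C : Fin (suc n') → Fin (suc m') → ℤ, C i j = c_{i+1, j+1}
--  a : Fin n' → ℤ,   a i = a_{i+2}
--  b : Fin m' → ℤ,   b j = b_{j+2}
-- Rows of M: first n rows (block A|C), then m-1 rows (block B|D).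
-- Columns of M: first n-1 columns (blocks A,B), then m columns (C,D).

colIdx : (n' m' : ℕ) → Fin (suc (n' ℕ.+ m')) → Fin (n' ℕ.+ suc m')
colIdx n' m' = cast (sym (+-suc n' m'))

entry : (n' m' : ℕ) → (Fin (suc n') → Fin (suc m') → ℤ) → (Fin n' → ℤ) → (Fin m' → ℤ) →
        Fin (suc n') ⊎ Fin m' → Fin n' ⊎ Fin (suc m') → ℤ
entry n' m' C a b (inj₁ zero)    (inj₁ k) = 0ℤ
entry n' m' C a b (inj₁ (suc i)) (inj₁ k) with i ≟ k
... | yes _ = a i
... | no  _ = 0ℤ
entry n' m' C a b (inj₁ i) (inj₂ j) = C i j
entry n' m' C a b (inj₂ j) (inj₁ k) = C (suc k) (suc j)
entry n' m' C a b (inj₂ j) (inj₂ zero)     = 0ℤ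
entry n' m' C a b (inj₂ j) (inj₂ (suc j')) with j ≟ j'
... | yes _ = b j
... | no  _ = 0ℤ

bigM : (n' m' : ℕ) → (Fin (suc n') → Fin (suc m') → ℤ) → (Fin n' → ℤ) → (Fin m' → ℤ) →
       Mat (suc (n' ℕ.+ m'))
bigM n' m' C a b r c = entry n' m' C a b (splitAt (suc n') r) (splitAt n' (colIdx n' m' c))

-- Subtracting from every column of the C|D block except the first its left neighbour (right to
-- left, so the determinant is unchanged) turns the first row (0 … 0 −1 … −1) into −e_n, and
-- expanding along it gives det M = (−1)ⁿ det M₀ for the minor M₀ at that entry. Let λᵢ be the
-- number of −1's in row i of C, which by the Ferrers condition form a prefix of the row. In M₀ the
-- row of aᵢ has its only other nonzero entry in the difference column j with λᵢ = j − 1, the row of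
-- b_j has −1's in the A-columns of the rows with j ≤ λᵢ and −b_j in difference column j + 1. So
-- with key 2λᵢ for the index i of the first block and key 2j − 1 for the index j of the second,
-- every nonzero off-diagonal entry of M₀ goes from a smaller to a larger key: M₀ is triangular up
-- to a simultaneous permutation of rows and columns, and det M₀ = ∏ aᵢ ∏ b_j.

module Submission where

open import Defs
open import Data.Nat as ℕ using (ℕ; suc)
open import Data.Integer using (ℤ; 0ℤ; -1ℤ; _*_; _^_) renaming (_≤_ to _≤ℤ_)
open import Data.Fin using (Fin; zero; suc; _≤_; _↑ˡ_; _↑ʳ_; cast)
open import Data.Sum using (_⊎_)
open import Data.Nat.Properties using (+-suc)
open import Relation.Binary.PropositionalEquality using (_≡_)

open import Data.Integer using (1ℤ; _+_; _-_)
import Data.Integer.Properties as ℤ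
import Data.Nat.Properties as ℕ
open import Data.Integer.Solver using (module +-*-Solver)
open +-*-Solver using (solve; _:+_; _:-_; _:*_; _:=_; con)
open import Data.Fin as Fin using (toℕ; fromℕ; punchIn; punchOut; inject₁; splitAt; join)
import Data.Fin.Properties as Fin
open import Data.Sum using (inj₁; inj₂; map₁; [_,_]′)
open import Data.Product using (∃; _,_; _×_)
open import Data.Empty using (⊥-elim)
open import Function using (_∘_; id)
open import Function.Definitions using (Injective)
open import Relation.Nullary using (¬_; Dec; yes; no)
open import Relation.Binary.PropositionalEquality
  using (_≢_; refl; sym; trans; cong; cong₂; subst; module ≡-Reasoning)

Σ-cong : ∀ k {f g : Fin k → ℤ} → (∀ i → f i ≡ g i) → Σ k f ≡ Σ k g
Σ-cong ℕ.zero    f≗g = refl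
Σ-cong (suc k) f≗g = cong₂ _+_ (f≗g zero) (Σ-cong k (f≗g ∘ suc))

Π-cong : ∀ k {f g : Fin k → ℤ} → (∀ i → f i ≡ g i) → Π k f ≡ Π k g
Π-cong ℕ.zero    f≗g = refl
Π-cong (suc k) f≗g = cong₂ _*_ (f≗g zero) (Π-cong k (f≗g ∘ suc))

Σ-zero : ∀ k {f : Fin k → ℤ} → (∀ i → f i ≡ 0ℤ) → Σ k f ≡ 0ℤ
Σ-zero ℕ.zero    f≗0 = refl
Σ-zero (suc k) f≗0 = cong₂ _+_ (f≗0 zero) (Σ-zero k (f≗0 ∘ suc))

Σ-distrib-- : ∀ k {f g h : Fin k → ℤ} → (∀ i → f i ≡ g i - h i) → Σ k f ≡ Σ k g - Σ k h
Σ-distrib-- ℕ.zero    _ = refl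
Σ-distrib-- (suc k) {f} {g} {h} f≗g-h =
  trans (cong₂ _+_ (f≗g-h zero) (Σ-distrib-- k (f≗g-h ∘ suc)))
        (interchange (g zero) (h zero) (Σ k (g ∘ suc)) (Σ k (h ∘ suc)))
  where
  interchange : ∀ x y z w → (x - y) + (z - w) ≡ (x + z) - (y + w)
  interchange = solve 4 (λ x y z w → (x :- y) :+ (z :- w) := (x :+ z) :- (y :+ w)) refl

Σ-single : ∀ k (f : Fin k → ℤ) i → (∀ j → j ≢ i → f j ≡ 0ℤ) → Σ k f ≡ f i
Σ-single (suc k) f zero    others =
  trans (cong (f zero +_) (Σ-zero k (λ j → others (suc j) λ ())))
        (ℤ.+-identityʳ (f zero))
Σ-single (suc k) f (suc i) others =
  trans (cong₂ _+_ (others zero λ ())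
                   (Σ-single k (f ∘ suc) i (λ j j≢i → others (suc j) (j≢i ∘ Fin.suc-injective))))
        (ℤ.+-identityˡ (f (suc i)))

Σ-adjacent : ∀ k (f : Fin (suc k) → ℤ) (c : Fin k) →
             (∀ j → j ≢ inject₁ c → j ≢ suc c → f j ≡ 0ℤ) →
             f (inject₁ c) + f (suc c) ≡ 0ℤ → Σ (suc k) f ≡ 0ℤ
Σ-adjacent (suc k) f zero    others cancel =
  trans (cong (λ s → f zero + (f (suc zero) + s))
              (Σ-zero k (λ j → others (suc (suc j)) (λ ()) (λ ()))))
        (trans (cong (f zero +_) (ℤ.+-identityʳ (f (suc zero)))) cancel)
Σ-adjacent (suc k) f (suc c) others cancel =
  cong₂ _+_ (others zero (λ ()) (λ ()))
            (Σ-adjacent k (f ∘ suc) c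
               (λ j j≢c j≢c+1 → others (suc j) (j≢c ∘ Fin.suc-injective) (j≢c+1 ∘ Fin.suc-injective))
               cancel)

Π-++ : ∀ n m (f : Fin (n ℕ.+ m) → ℤ) → Π (n ℕ.+ m) f ≡ Π n (λ i → f (i ↑ˡ m)) * Π m (λ j → f (n ↑ʳ j))
Π-++ ℕ.zero    m f = sym (ℤ.*-identityˡ _)
Π-++ (suc n) m f = trans (cong (f zero *_) (Π-++ n m (f ∘ suc))) (sym (ℤ.*-assoc (f zero) _ _))

minor : ∀ {k} → Mat (suc k) → Fin (suc k) → Mat k
minor M j r c = M (suc r) (punchIn j c)

laplaceTerm : ∀ {k} → Mat (suc k) → Fin (suc k) → ℤ
laplaceTerm {k} M j = (-1ℤ ^ toℕ j) * (M zero j * det k (minor M j))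

laplaceTerm-zeroMinor : ∀ {k} (M : Mat (suc k)) j → det k (minor M j) ≡ 0ℤ → laplaceTerm M j ≡ 0ℤ
laplaceTerm-zeroMinor M j d≡0 = begin
  (-1ℤ ^ toℕ j) * (M zero j * _) ≡⟨ cong (λ d → (-1ℤ ^ toℕ j) * (M zero j * d)) d≡0 ⟩
  (-1ℤ ^ toℕ j) * (M zero j * 0ℤ) ≡⟨ cong ((-1ℤ ^ toℕ j) *_) (ℤ.*-zeroʳ (M zero j)) ⟩
  (-1ℤ ^ toℕ j) * 0ℤ              ≡⟨ ℤ.*-zeroʳ (-1ℤ ^ toℕ j) ⟩
  0ℤ                              ∎
  where open ≡-Reasoning

laplaceTerm-zeroEntry : ∀ {k} (M : Mat (suc k)) j → M zero j ≡ 0ℤ → laplaceTerm M j ≡ 0ℤ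
laplaceTerm-zeroEntry {k} M j m≡0 =
  trans (cong (λ m → (-1ℤ ^ toℕ j) * (m * det k (minor M j))) m≡0) (ℤ.*-zeroʳ (-1ℤ ^ toℕ j))

det-cong : ∀ k {M N : Mat k} → (∀ r c → M r c ≡ N r c) → det k M ≡ det k N
det-cong ℕ.zero    M≗N = refl
det-cong (suc k) M≗N = Σ-cong (suc k) λ j →
  cong₂ (λ x d → (-1ℤ ^ toℕ j) * (x * d)) (M≗N zero j) (det-cong k (λ r c → M≗N (suc r) (punchIn j c)))

det-linear-column : ∀ k (c : Fin k) (M P Q : Mat k) →
  (∀ r x → x ≢ c → M r x ≡ P r x) → (∀ r x → x ≢ c → M r x ≡ Q r x) →
  (∀ r → M r c ≡ P r c - Q r c) → det k M ≡ det k P - det k Q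
det-linear-column (suc k) c M P Q M≗P M≗Q Mc =
  Σ-distrib-- (suc k) {laplaceTerm M} {laplaceTerm P} {laplaceTerm Q} term
  where
  term : ∀ j → laplaceTerm M j ≡ laplaceTerm P j - laplaceTerm Q j
  term j with j Fin.≟ c
  ... | yes refl = begin
      s * (M zero c * det k (minor M c))        ≡⟨ cong₂ (λ x d → s * (x * d)) (Mc zero) (sameMinor M≗P) ⟩
      s * ((P zero c - Q zero c) * dP)          ≡⟨ distrib s (P zero c) (Q zero c) dP ⟩
      s * (P zero c * dP) - s * (Q zero c * dP) ≡⟨ cong (λ d → s * (P zero c * dP) - s * (Q zero c * d))
                                                        (trans (sym (sameMinor M≗P)) (sameMinor M≗Q)) ⟩
      laplaceTerm P c - laplaceTerm Q c         ∎
    where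
    open ≡-Reasoning
    s dP : ℤ
    s  = -1ℤ ^ toℕ c
    dP = det k (minor P c)
    sameMinor : ∀ {N} → (∀ r x → x ≢ c → M r x ≡ N r x) → det k (minor M c) ≡ det k (minor N c)
    sameMinor M≗N = det-cong k λ r x → M≗N (suc r) (punchIn c x) (Fin.punchInᵢ≢i c x)
    distrib : ∀ s x y d → s * ((x - y) * d) ≡ s * (x * d) - s * (y * d)
    distrib = solve 4 (λ s x y d → s :* ((x :- y) :* d) := s :* (x :* d) :- s :* (y :* d)) refl
  ... | no j≢c = begin
      s * (M zero j * det k (minor M j))                  ≡⟨ cong (λ d → s * (M zero j * d)) minor-linear ⟩
      s * (M zero j * (det k (minor P j) - det k (minor Q j)))
        ≡⟨ distrib s (M zero j) (det k (minor P j)) (det k (minor Q j)) ⟩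
      s * (M zero j * det k (minor P j)) - s * (M zero j * det k (minor Q j))
        ≡⟨ cong₂ (λ x y → s * (x * det k (minor P j)) - s * (y * det k (minor Q j)))
                 (M≗P zero j j≢c) (M≗Q zero j j≢c) ⟩
      laplaceTerm P j - laplaceTerm Q j                   ∎
    where
    open ≡-Reasoning
    s : ℤ
    s = -1ℤ ^ toℕ j
    c′ : Fin k
    c′ = punchOut j≢c
    punchIn≢c : ∀ {x} → x ≢ c′ → punchIn j x ≢ c
    punchIn≢c x≢c′ e = x≢c′ (Fin.punchIn-injective j _ c′ (trans e (sym (Fin.punchIn-punchOut j≢c))))
    minor-linear : det k (minor M j) ≡ det k (minor P j) - det k (minor Q j)
    minor-linear = det-linear-column k c′ (minor M j) (minor P j) (minor Q j)
      (λ r x x≢c′ → M≗P (suc r) (punchIn j x) (punchIn≢c x≢c′))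
      (λ r x x≢c′ → M≗Q (suc r) (punchIn j x) (punchIn≢c x≢c′))
      (λ r → subst (λ y → M (suc r) y ≡ P (suc r) y - Q (suc r) y)
                   (sym (Fin.punchIn-punchOut j≢c)) (Mc (suc r)))
    distrib : ∀ s x d e → s * (x * (d - e)) ≡ s * (x * d) - s * (x * e)
    distrib = solve 4 (λ s x d e → s :* (x :* (d :- e)) := s :* (x :* d) :- s :* (x :* e)) refl

inject₁≢suc : ∀ {k} (c : Fin k) → inject₁ c ≢ suc c
inject₁≢suc (suc c) e = inject₁≢suc c (Fin.suc-injective e)

punchIn-adjacent : ∀ {k} (j : Fin (suc (suc k))) (c : Fin (suc k)) → j ≢ inject₁ c → j ≢ suc c →
                   ∃ λ e → punchIn j (inject₁ e) ≡ inject₁ c × punchIn j (suc e) ≡ suc c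
punchIn-adjacent zero          zero    j≢c _     = ⊥-elim (j≢c refl)
punchIn-adjacent zero          (suc c) _   _     = c , refl , refl
punchIn-adjacent (suc zero)    zero    _   j≢c+1 = ⊥-elim (j≢c+1 refl)
punchIn-adjacent {suc k} (suc (suc j)) zero _ _  = zero , refl , refl
punchIn-adjacent {suc k} (suc j) (suc c) j≢c j≢c+1
  with e , p , q ← punchIn-adjacent j c (j≢c ∘ cong suc) (j≢c+1 ∘ cong suc)
  = suc e , cong suc p , cong suc q

punchIn-swapAdjacent : ∀ {k} (g : Fin (suc (suc k)) → ℤ) (c : Fin (suc k)) → g (inject₁ c) ≡ g (suc c) →
                       ∀ x → g (punchIn (inject₁ c) x) ≡ g (punchIn (suc c) x)
punchIn-swapAdjacent g zero    g≡ zero    = sym g≡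
punchIn-swapAdjacent g zero    g≡ (suc x) = refl
punchIn-swapAdjacent {suc k} g (suc c) g≡ zero    = refl
punchIn-swapAdjacent {suc k} g (suc c) g≡ (suc x) = punchIn-swapAdjacent (g ∘ suc) c g≡ x

det-equalAdjacentColumns : ∀ k (M : Mat (suc k)) (c : Fin k) →
                           (∀ r → M r (inject₁ c) ≡ M r (suc c)) → det (suc k) M ≡ 0ℤ
det-equalAdjacentColumns (suc k) M c equal = Σ-adjacent (suc k) (laplaceTerm M) c others cancel
  where
  others : ∀ j → j ≢ inject₁ c → j ≢ suc c → laplaceTerm M j ≡ 0ℤ
  others j j≢c j≢c+1 with e , p , q ← punchIn-adjacent j c j≢c j≢c+1 =
    laplaceTerm-zeroMinor M j (det-equalAdjacentColumns k (minor M j) e λ r →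
      trans (cong (M (suc r)) p) (trans (equal (suc r)) (cong (M (suc r)) (sym q))))
  cancel : laplaceTerm M (inject₁ c) + laplaceTerm M (suc c) ≡ 0ℤ
  cancel = trans
    (cong (_+ laplaceTerm M (suc c))
      (cong₂ (λ t x → (-1ℤ ^ t) * x) (Fin.toℕ-inject₁ c)
        (cong₂ _*_ (equal zero)
                   (det-cong (suc k) λ r → punchIn-swapAdjacent (M (suc r)) c (equal (suc r))))))
    (alternating (-1ℤ ^ toℕ c) (M zero (suc c) * det (suc k) (minor M (suc c))))
    where
    alternating : ∀ s x → s * x + (-1ℤ * s) * x ≡ 0ℤ
    alternating = solve 2 (λ s x → s :* x :+ (con -1ℤ :* s) :* x := con 0ℤ) refl

replaceColumn : ∀ {k} → Mat k → Fin k → (Fin k → ℤ) → Mat k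
replaceColumn M c w r x with x Fin.≟ c
... | yes _ = w r
... | no  _ = M r x

replaceColumn-at : ∀ {k} (M : Mat k) c w r → replaceColumn M c w r c ≡ w r
replaceColumn-at M c w r with c Fin.≟ c
... | yes _   = refl
... | no  c≢c = ⊥-elim (c≢c refl)

replaceColumn-elsewhere : ∀ {k} (M : Mat k) c w r x → x ≢ c → replaceColumn M c w r x ≡ M r x
replaceColumn-elsewhere M c w r x x≢c with x Fin.≟ c
... | yes x≡c = ⊥-elim (x≢c x≡c)
... | no  _   = refl

det-subtractPreviousColumn : ∀ k (M N : Mat (suc k)) (c : Fin k) →
  (∀ r x → x ≢ suc c → N r x ≡ M r x) → (∀ r → N r (suc c) ≡ M r (suc c) - M r (inject₁ c)) →
  det (suc k) N ≡ det (suc k) M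
det-subtractPreviousColumn k M N c N≗M Nc = begin
  det (suc k) N               ≡⟨ det-linear-column (suc k) (suc c) N M Q N≗M N≗Q N≡M-Q ⟩
  det (suc k) M - det (suc k) Q ≡⟨ cong (det (suc k) M -_) Q-singular ⟩
  det (suc k) M - 0ℤ          ≡⟨ ℤ.+-identityʳ (det (suc k) M) ⟩
  det (suc k) M               ∎
  where
  open ≡-Reasoning
  Q : Mat (suc k)
  Q = replaceColumn M (suc c) (λ r → M r (inject₁ c))
  N≗Q : ∀ r x → x ≢ suc c → N r x ≡ Q r x
  N≗Q r x x≢c = trans (N≗M r x x≢c) (sym (replaceColumn-elsewhere M (suc c) _ r x x≢c))
  N≡M-Q : ∀ r → N r (suc c) ≡ M r (suc c) - Q r (suc c)
  N≡M-Q r = trans (Nc r) (cong (M r (suc c) -_) (sym (replaceColumn-at M (suc c) _ r)))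
  Q-singular : det (suc k) Q ≡ 0ℤ
  Q-singular = det-equalAdjacentColumns k Q c λ r →
    trans (replaceColumn-elsewhere M (suc c) _ r (inject₁ c) (inject₁≢suc c))
          (sym (replaceColumn-at M (suc c) _ r))

differenceFrom : ∀ {k} → ℕ → Mat (suc k) → Mat (suc k)
differenceFrom p M r zero    = M r zero
differenceFrom p M r (suc y) with p ℕ.≤? toℕ y
... | yes _ = M r (suc y) - M r (inject₁ y)
... | no  _ = M r (suc y)

differenceFrom-≥ : ∀ {k} p (M : Mat (suc k)) r y → p ℕ.≤ toℕ y →
                   differenceFrom p M r (suc y) ≡ M r (suc y) - M r (inject₁ y)
differenceFrom-≥ p M r y p≤y with p ℕ.≤? toℕ y
... | yes _   = refl
... | no  p≰y = ⊥-elim (p≰y p≤y)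

differenceFrom-≱ : ∀ {k} p (M : Mat (suc k)) r y → ¬ p ℕ.≤ toℕ y → differenceFrom p M r (suc y) ≡ M r (suc y)
differenceFrom-≱ p M r y p≰y with p ℕ.≤? toℕ y
... | yes p≤y = ⊥-elim (p≰y p≤y)
... | no  _   = refl

differenceFrom-≤ : ∀ {k} p (M : Mat (suc k)) r y → toℕ y ℕ.≤ p → differenceFrom p M r y ≡ M r y
differenceFrom-≤ p M r zero    _   = refl
differenceFrom-≤ p M r (suc y) y<p = differenceFrom-≱ p M r y (ℕ.<⇒≱ y<p)

det-differenceFrom-step : ∀ k (c : Fin k) (M : Mat (suc k)) →
                          det (suc k) (differenceFrom (toℕ c) M) ≡ det (suc k) (differenceFrom (suc (toℕ c)) M)
det-differenceFrom-step k c M = det-subtractPreviousColumn k M′ (differenceFrom (toℕ c) M) c agree at-c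
  where
  M′ : Mat (suc k)
  M′ = differenceFrom (suc (toℕ c)) M
  agree : ∀ r x → x ≢ suc c → differenceFrom (toℕ c) M r x ≡ M′ r x
  agree r zero    _     = refl
  agree r (suc y) y≢c with toℕ c ℕ.≤? toℕ y
  ... | yes c≤y = sym (differenceFrom-≥ (suc (toℕ c)) M r y
                        (ℕ.≤∧≢⇒< c≤y (λ c≡y → y≢c (cong suc (Fin.toℕ-injective (sym c≡y))))))
  ... | no  c≰y = sym (differenceFrom-≱ (suc (toℕ c)) M r y (c≰y ∘ ℕ.<⇒≤))
  at-c : ∀ r → differenceFrom (toℕ c) M r (suc c) ≡ M′ r (suc c) - M′ r (inject₁ c)
  at-c r = trans (differenceFrom-≥ (toℕ c) M r c ℕ.≤-refl)
    (sym (cong₂ _-_ (differenceFrom-≱ (suc (toℕ c)) M r c (ℕ.<-irrefl refl))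
                    (differenceFrom-≤ (suc (toℕ c)) M r (inject₁ c)
                       (ℕ.≤-trans (ℕ.≤-reflexive (Fin.toℕ-inject₁ c)) (ℕ.n≤1+n (toℕ c))))))

det-differenceFrom : ∀ k d p → p ℕ.+ d ≡ k → (M : Mat (suc k)) → det (suc k) (differenceFrom p M) ≡ det (suc k) M
det-differenceFrom k ℕ.zero p p≡k M = det-cong (suc k) unchanged
  where
  unchanged : ∀ r x → differenceFrom p M r x ≡ M r x
  unchanged r zero    = refl
  unchanged r (suc y) = differenceFrom-≱ p M r y
    (ℕ.<⇒≱ (subst (toℕ y ℕ.<_) (trans (sym p≡k) (ℕ.+-identityʳ p)) (Fin.toℕ<n y)))
det-differenceFrom k (suc d) p p+d+1≡k M = begin
  det (suc k) (differenceFrom p M)            ≡⟨ cong (λ q → det (suc k) (differenceFrom q M)) (sym c≡p) ⟩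
  det (suc k) (differenceFrom (toℕ c) M)       ≡⟨ det-differenceFrom-step k c M ⟩
  det (suc k) (differenceFrom (suc (toℕ c)) M) ≡⟨ cong (λ q → det (suc k) (differenceFrom (suc q) M)) c≡p ⟩
  det (suc k) (differenceFrom (suc p) M)      ≡⟨ det-differenceFrom k d (suc p) (trans (sym (+-suc p d)) p+d+1≡k) M ⟩
  det (suc k) M                               ∎
  where
  open ≡-Reasoning
  p<k : p ℕ.< k
  p<k = subst (p ℕ.<_) p+d+1≡k (ℕ.m<m+n p (ℕ.s≤s ℕ.z≤n))
  c : Fin k
  c = Fin.fromℕ< p<k
  c≡p : toℕ c ≡ p
  c≡p = Fin.toℕ-fromℕ< p<k

module KeyOrdered {L : ℕ} (key : Fin L → ℕ) where

  KeyUpper : ∀ k → Mat k → (Fin k → Fin L) → (Fin k → Fin L) → Set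
  KeyUpper k N ρ γ = ∀ r c → N r c ≢ 0ℤ → ρ r ≢ γ c → key (ρ r) ℕ.< key (γ c)

  -- A dominant extra row survives every expansion step with nonzero
  -- entry, and there is none in a 0 × 0 matrix, so it forces the determinant to vanish.
  record DominantExtraRow (k : ℕ) (ρ γ : Fin k → Fin L) : Set where
    field
      row       : Fin k
      unmatched : ∀ c → γ c ≢ ρ row
      dominates : ∀ c → (∀ r → ρ r ≢ γ c) → key (γ c) ℕ.≤ key (ρ row)

  notRowLabel : ∀ {k} (ρ : Fin (suc k) → Fin L) {g} → ρ zero ≢ g → (∀ r → ρ (suc r) ≢ g) → ∀ r → ρ r ≢ g
  notRowLabel ρ ρ₀≢g _    zero    = ρ₀≢g
  notRowLabel ρ _    ρₛ≢g (suc r) = ρₛ≢g r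

  module _ {k : ℕ} (ρ γ : Fin (suc k) → Fin L) (γ-inj : Injective _≡_ _≡_ γ) (j : Fin (suc k)) where

    private
      γ′ : Fin k → Fin L
      γ′ = γ ∘ punchIn j

      γ′≢γj : ∀ c → γ′ c ≢ γ j
      γ′≢γj c = Fin.punchInᵢ≢i j c ∘ γ-inj

      dominated-below : ∀ t → key (ρ zero) ℕ.≤ t → (∀ c → (∀ r → ρ r ≢ γ c) → key (γ c) ℕ.≤ t) →
                        ∀ c → (∀ r → ρ (suc r) ≢ γ′ c) → key (γ′ c) ℕ.≤ t
      dominated-below t ρ₀≤t bound c notRow with ρ zero Fin.≟ γ′ c
      ... | yes ρ₀≡γ′c = subst (λ g → key g ℕ.≤ t) ρ₀≡γ′c ρ₀≤t
      ... | no  ρ₀≢γ′c = bound (punchIn j c) (notRowLabel ρ ρ₀≢γ′c notRow)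

    dominantExtraRow-minor : DominantExtraRow (suc k) ρ γ → ρ zero ≡ γ j ⊎ key (ρ zero) ℕ.< key (γ j) →
                             DominantExtraRow k (ρ ∘ suc) γ′
    dominantExtraRow-minor D@record { row = zero } (inj₁ ρ₀≡γj) = ⊥-elim (unmatched j (sym ρ₀≡γj))
      where open DominantExtraRow D
    dominantExtraRow-minor D@record { row = suc x } (inj₁ ρ₀≡γj) = record
      { row       = x
      ; unmatched = unmatched ∘ punchIn j
      ; dominates = λ c notRow → dominates (punchIn j c)
                      (notRowLabel ρ (λ ρ₀≡γ′c → γ′≢γj c (trans (sym ρ₀≡γ′c) ρ₀≡γj)) notRow)
      }
      where open DominantExtraRow D
    dominantExtraRow-minor D (inj₂ ρ₀<γj) with key (γ j) ℕ.≤? key (ρ (DominantExtraRow.row D))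
    ... | yes γj≤row = keepRow D γj≤row
      where
      keepRow : (D : DominantExtraRow (suc k) ρ γ) → key (γ j) ℕ.≤ key (ρ (DominantExtraRow.row D)) →
                DominantExtraRow k (ρ ∘ suc) γ′
      keepRow record { row = zero } γj≤ρ₀ = ⊥-elim (ℕ.<⇒≱ ρ₀<γj γj≤ρ₀)
      keepRow D@record { row = suc x } γj≤row = record
        { row       = x
        ; unmatched = unmatched ∘ punchIn j
        ; dominates = dominated-below (key (ρ (suc x))) (ℕ.<⇒≤ (ℕ.<-≤-trans ρ₀<γj γj≤row)) dominates
        }
        where open DominantExtraRow D
    ... | no  γj≰row with Fin.any? (λ r → ρ (suc r) Fin.≟ γ j)
    ...   | yes (r , ρr≡γj) = record
      { row       = r
      ; unmatched = λ c γ′c≡ρr → γ′≢γj c (trans γ′c≡ρr ρr≡γj)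
      ; dominates = subst (λ g → ∀ c → (∀ r → ρ (suc r) ≢ γ′ c) → key (γ′ c) ℕ.≤ key g) (sym ρr≡γj)
                      (dominated-below (key (γ j)) (ℕ.<⇒≤ ρ₀<γj)
                         (λ c notRow → ℕ.≤-trans (dominates c notRow) (ℕ.<⇒≤ (ℕ.≰⇒> γj≰row))))
      }
      where open DominantExtraRow D
    ...   | no  γj∉ρ = ⊥-elim (γj≰row (DominantExtraRow.dominates D j
                          (notRowLabel ρ (λ ρ₀≡γj → ℕ.<-irrefl (cong key ρ₀≡γj) ρ₀<γj)
                                         (λ r ρr≡γj → γj∉ρ (r , ρr≡γj)))))

  det-dominantExtraRow : ∀ k (N : Mat k) (ρ γ : Fin k → Fin L) → Injective _≡_ _≡_ γ →
                         KeyUpper k N ρ γ → DominantExtraRow k ρ γ → det k N ≡ 0ℤ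
  det-dominantExtraRow ℕ.zero N ρ γ _ _ record { row = () }
  det-dominantExtraRow (suc k) N ρ γ γ-inj upper D = Σ-zero (suc k) term
    where
    term : ∀ j → laplaceTerm N j ≡ 0ℤ
    term j with N zero j ℤ.≟ 0ℤ
    ... | yes N₀j≡0 = laplaceTerm-zeroEntry N j N₀j≡0
    ... | no  N₀j≢0 = laplaceTerm-zeroMinor N j
      (det-dominantExtraRow k (minor N j) (ρ ∘ suc) (γ ∘ punchIn j)
         (Fin.punchIn-injective j _ _ ∘ γ-inj) (λ r c → upper (suc r) (punchIn j c))
         (dominantExtraRow-minor ρ γ γ-inj j D (matchedOrAbove (ρ zero Fin.≟ γ j))))
      where
      matchedOrAbove : Dec (ρ zero ≡ γ j) → ρ zero ≡ γ j ⊎ key (ρ zero) ℕ.< key (γ j)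
      matchedOrAbove (yes ρ₀≡γj) = inj₁ ρ₀≡γj
      matchedOrAbove (no  ρ₀≢γj) = inj₂ (upper zero j N₀j≢0 ρ₀≢γj)

det-keyUpperTriangular : ∀ k (key : Fin k → ℕ) (N : Mat k) →
                         (∀ r c → N r c ≢ 0ℤ → r ≢ c → key r ℕ.< key c) → det k N ≡ Π k (λ i → N i i)
det-keyUpperTriangular ℕ.zero    key N upper = refl
det-keyUpperTriangular (suc k) key N upper = begin
  laplaceTerm N zero + Σ k (laplaceTerm N ∘ suc)  ≡⟨ cong (laplaceTerm N zero +_) (Σ-zero k offDiagonal) ⟩
  laplaceTerm N zero + 0ℤ                         ≡⟨ ℤ.+-identityʳ _ ⟩
  1ℤ * (N zero zero * det k (minor N zero))       ≡⟨ ℤ.*-identityˡ _ ⟩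
  N zero zero * det k (minor N zero)              ≡⟨ cong (N zero zero *_) diagonalMinor ⟩
  Π (suc k) (λ i → N i i)                         ∎
  where
  open ≡-Reasoning
  diagonalMinor : det k (minor N zero) ≡ Π k (λ i → N (suc i) (suc i))
  diagonalMinor = det-keyUpperTriangular k (key ∘ suc) (minor N zero)
                    (λ r c Nrc≢0 r≢c → upper (suc r) (suc c) Nrc≢0 (r≢c ∘ Fin.suc-injective))
  offDiagonal : ∀ c → laplaceTerm N (suc c) ≡ 0ℤ
  offDiagonal c with N zero (suc c) ℤ.≟ 0ℤ
  ... | yes N₀c≡0 = laplaceTerm-zeroEntry N (suc c) N₀c≡0
  ... | no  N₀c≢0 = laplaceTerm-zeroMinor N (suc c)
    (det-dominantExtraRow k (minor N (suc c)) suc (punchIn (suc c)) (Fin.punchIn-injective (suc c) _ _)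
       (λ r x → upper (suc r) (punchIn (suc c) x))
       record { row = c ; unmatched = Fin.punchInᵢ≢i (suc c) ; dominates = dominates })
    where
    open KeyOrdered key
    dominates : ∀ x → (∀ r → suc r ≢ punchIn (suc c) x) → key (punchIn (suc c) x) ℕ.≤ key (suc c)
    dominates zero    _      = ℕ.<⇒≤ (upper zero (suc c) N₀c≢0 λ ())
    dominates (suc x) notRow = ⊥-elim (notRow (punchIn c x) refl)

leadingNegOnes : ∀ {k} → (Fin k → ℤ) → ℕ
leadingNegOnes {ℕ.zero} f = 0
leadingNegOnes {suc k}  f with f zero ℤ.≟ -1ℤ
... | yes _ = suc (leadingNegOnes (f ∘ suc))
... | no  _ = 0

leadingNegOnes-≤ : ∀ {k} (f : Fin k → ℤ) j → f j ≢ -1ℤ → leadingNegOnes f ℕ.≤ toℕ j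
leadingNegOnes-≤ {suc k} f j fj≢-1 with f zero ℤ.≟ -1ℤ
leadingNegOnes-≤ {suc k} f zero    f₀≢-1 | yes f₀≡-1 = ⊥-elim (f₀≢-1 f₀≡-1)
leadingNegOnes-≤ {suc k} f (suc j) fj≢-1 | yes _     = ℕ.s≤s (leadingNegOnes-≤ (f ∘ suc) j fj≢-1)
... | no _ = ℕ.z≤n

<-leadingNegOnes : ∀ {k} (f : Fin k → ℤ) → (∀ j j′ → f j ≡ -1ℤ → j′ ≤ j → f j′ ≡ -1ℤ) →
                   ∀ j → f j ≡ -1ℤ → toℕ j ℕ.< leadingNegOnes f
<-leadingNegOnes {suc k} f prefix j fj≡-1 with f zero ℤ.≟ -1ℤ
<-leadingNegOnes {suc k} f prefix zero    fj≡-1 | yes _ = ℕ.s≤s ℕ.z≤n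
<-leadingNegOnes {suc k} f prefix (suc j) fj≡-1 | yes _ =
  ℕ.s≤s (<-leadingNegOnes (f ∘ suc) (λ j j′ e j′≤j → prefix (suc j) (suc j′) e (ℕ.s≤s j′≤j)) j fj≡-1)
... | no f₀≢-1 = ⊥-elim (f₀≢-1 (prefix j zero fj≡-1 ℕ.z≤n))

punchIn-fromℕ-↑ˡ : ∀ {n} m (k : Fin n) → punchIn (fromℕ n ↑ˡ m) (k ↑ˡ m) ≡ inject₁ (k ↑ˡ m)
punchIn-fromℕ-↑ˡ m zero    = refl
punchIn-fromℕ-↑ˡ m (suc k) = cong suc (punchIn-fromℕ-↑ˡ m k)

punchIn-fromℕ-↑ʳ : ∀ n {m} (l : Fin m) → punchIn (fromℕ n ↑ˡ m) (n ↑ʳ l) ≡ suc (n ↑ʳ l)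
punchIn-fromℕ-↑ʳ ℕ.zero    l = refl
punchIn-fromℕ-↑ʳ (suc n) l = cong suc (punchIn-fromℕ-↑ʳ n l)

colIdx-inject₁-↑ˡ : ∀ {n} m (k : Fin n) → colIdx n m (inject₁ (k ↑ˡ m)) ≡ k ↑ˡ suc m
colIdx-inject₁-↑ˡ m zero    = refl
colIdx-inject₁-↑ˡ m (suc k) = cong suc (colIdx-inject₁-↑ˡ m k)

colIdx-suc-↑ʳ : ∀ n {m} (l : Fin m) → colIdx n m (suc (n ↑ʳ l)) ≡ n ↑ʳ suc l
colIdx-suc-↑ʳ ℕ.zero    l = Fin.cast-is-id refl (suc l)
colIdx-suc-↑ʳ (suc n) l = cong suc (colIdx-suc-↑ʳ n l)

colIdx-inject₁-↑ʳ : ∀ n {m} (l : Fin m) → colIdx n m (inject₁ (n ↑ʳ l)) ≡ n ↑ʳ inject₁ l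
colIdx-inject₁-↑ʳ ℕ.zero    l = Fin.cast-is-id refl (inject₁ l)
colIdx-inject₁-↑ʳ (suc n) l = cong suc (colIdx-inject₁-↑ʳ n l)

module BlockMatrix (n' m' : ℕ) (C : Fin (suc n') → Fin (suc m') → ℤ) (a : Fin n' → ℤ) (b : Fin m' → ℤ) where

  K : ℕ
  K = n' ℕ.+ m'

  E : Fin (suc n') ⊎ Fin m' → Fin n' ⊎ Fin (suc m') → ℤ
  E = entry n' m' C a b

  M : Mat (suc K)
  M = bigM n' m' C a b

  A-diagonal : ∀ i → E (inj₁ (suc i)) (inj₁ i) ≡ a i
  A-diagonal i with i Fin.≟ i
  ... | yes _   = refl
  ... | no  i≢i = ⊥-elim (i≢i refl)

  A-offDiagonal : ∀ i k → E (inj₁ (suc i)) (inj₁ k) ≢ 0ℤ → i ≡ k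
  A-offDiagonal i k nonzero with i Fin.≟ k
  ... | yes i≡k = i≡k
  ... | no  _   = ⊥-elim (nonzero refl)

  D-diagonal : ∀ j → E (inj₂ j) (inj₂ (suc j)) ≡ b j
  D-diagonal j with j Fin.≟ j
  ... | yes _   = refl
  ... | no  j≢j = ⊥-elim (j≢j refl)

  D-offDiagonal : ∀ j x → E (inj₂ j) (inj₂ x) ≢ 0ℤ → x ≡ suc j
  D-offDiagonal j zero    nonzero = ⊥-elim (nonzero refl)
  D-offDiagonal j (suc x) nonzero with j Fin.≟ x
  ... | yes j≡x = cong suc (sym j≡x)
  ... | no  _   = ⊥-elim (nonzero refl)

  D-inject₁ : ∀ j → E (inj₂ j) (inj₂ (inject₁ j)) ≡ 0ℤ
  D-inject₁ j with E (inj₂ j) (inj₂ (inject₁ j)) ℤ.≟ 0ℤ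
  ... | yes zero′   = zero′
  ... | no  nonzero = ⊥-elim (inject₁≢suc j (D-offDiagonal j (inject₁ j) nonzero))

  top-< : ∀ y → toℕ y ℕ.< n' → M zero y ≡ 0ℤ
  top-< y y<n = cong (E (inj₁ zero))
    (Fin.splitAt-< n' (colIdx n' m' y) (subst (ℕ._< n') (sym (Fin.toℕ-cast _ y)) y<n))

  top-≥ : (∀ j → C zero j ≡ -1ℤ) → ∀ y → n' ℕ.≤ toℕ y → M zero y ≡ -1ℤ
  top-≥ firstRow y n≤y = trans
    (cong (E (inj₁ zero)) (Fin.splitAt-≥ n' (colIdx n' m' y) (subst (n' ℕ.≤_) (sym (Fin.toℕ-cast _ y)) n≤y)))
    (firstRow _)

  N : Mat (suc K)
  N = differenceFrom n' M

  pivot : Fin (suc K)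
  pivot = fromℕ n' ↑ˡ m'

  toℕ-pivot : toℕ pivot ≡ n'
  toℕ-pivot = trans (Fin.toℕ-↑ˡ (fromℕ n') m') (Fin.toℕ-fromℕ n')

  N-top-pivot : (∀ j → C zero j ≡ -1ℤ) → N zero pivot ≡ -1ℤ
  N-top-pivot firstRow = trans (differenceFrom-≤ n' M zero pivot (ℕ.≤-reflexive toℕ-pivot))
                               (top-≥ firstRow pivot (ℕ.≤-reflexive (sym toℕ-pivot)))

  N-top-≤ : ∀ y → y ≢ pivot → toℕ y ℕ.≤ n' → N zero y ≡ 0ℤ
  N-top-≤ y y≢pivot y≤n = trans (differenceFrom-≤ n' M zero y y≤n) (top-< y (ℕ.≤∧≢⇒< y≤n y≢n))
    where
    y≢n : toℕ y ≢ n'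
    y≢n y≡n = y≢pivot (Fin.toℕ-injective (trans y≡n (sym toℕ-pivot)))

  N-top-> : (∀ j → C zero j ≡ -1ℤ) → ∀ y → n' ℕ.≤ toℕ y → N zero (suc y) ≡ 0ℤ
  N-top-> firstRow y n≤y = trans (differenceFrom-≥ n' M zero y n≤y)
    (cong₂ _-_ (top-≥ firstRow (suc y) (ℕ.m≤n⇒m≤1+n n≤y))
               (top-≥ firstRow (inject₁ y) (subst (n' ℕ.≤_) (sym (Fin.toℕ-inject₁ y)) n≤y)))

  N-top-elsewhere : (∀ j → C zero j ≡ -1ℤ) → ∀ y → y ≢ pivot → N zero y ≡ 0ℤ
  N-top-elsewhere firstRow zero    y≢pivot = N-top-≤ zero y≢pivot ℕ.z≤n
  N-top-elsewhere firstRow (suc y) y≢pivot =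
    [ N-top-> firstRow y , N-top-≤ (suc y) y≢pivot ]′ (ℕ.≤-<-connex n' (toℕ y))

  minorN : Mat K
  minorN = minor N pivot

  minorEntry : Fin n' ⊎ Fin m' → Fin n' ⊎ Fin m' → ℤ
  minorEntry u (inj₁ k) = E (map₁ suc u) (inj₁ k)
  minorEntry u (inj₂ l) = E (map₁ suc u) (inj₂ (suc l)) - E (map₁ suc u) (inj₂ (inject₁ l))

  M-join : ∀ u y {v} → splitAt n' (colIdx n' m' y) ≡ v → M (suc (join n' m' u)) y ≡ E (map₁ suc u) v
  M-join u y column = cong₂ (λ s t → E (map₁ suc s) t) (Fin.splitAt-join n' m' u) column

  minorN-join : ∀ u v → minorN (join n' m' u) (join n' m' v) ≡ minorEntry u v
  minorN-join u (inj₁ k) = begin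
    N r (punchIn pivot (k ↑ˡ m')) ≡⟨ cong (N r) (punchIn-fromℕ-↑ˡ m' k) ⟩
    N r (inject₁ (k ↑ˡ m'))       ≡⟨ differenceFrom-≤ n' M r (inject₁ (k ↑ˡ m')) left ⟩
    M r (inject₁ (k ↑ˡ m'))       ≡⟨ M-join u _ (trans (cong (splitAt n') (colIdx-inject₁-↑ˡ m' k))
                                                       (Fin.splitAt-↑ˡ n' k (suc m'))) ⟩
    minorEntry u (inj₁ k)        ∎
    where
    open ≡-Reasoning
    r : Fin (suc K)
    r = suc (join n' m' u)
    left : toℕ (inject₁ (k ↑ˡ m')) ℕ.≤ n'
    left = ℕ.≤-trans (ℕ.≤-reflexive (trans (Fin.toℕ-inject₁ (k ↑ˡ m')) (Fin.toℕ-↑ˡ k m')))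
                     (ℕ.<⇒≤ (Fin.toℕ<n k))
  minorN-join u (inj₂ l) = begin
    N r (punchIn pivot (n' ↑ʳ l))              ≡⟨ cong (N r) (punchIn-fromℕ-↑ʳ n' l) ⟩
    N r (suc (n' ↑ʳ l))                        ≡⟨ differenceFrom-≥ n' M r (n' ↑ʳ l) right ⟩
    M r (suc (n' ↑ʳ l)) - M r (inject₁ (n' ↑ʳ l))
      ≡⟨ cong₂ _-_ (M-join u _ (trans (cong (splitAt n') (colIdx-suc-↑ʳ n' l)) (Fin.splitAt-↑ʳ n' (suc m') (suc l))))
                   (M-join u _ (trans (cong (splitAt n') (colIdx-inject₁-↑ʳ n' l))
                                      (Fin.splitAt-↑ʳ n' (suc m') (inject₁ l)))) ⟩
    minorEntry u (inj₂ l)                     ∎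
    where
    open ≡-Reasoning
    r : Fin (suc K)
    r = suc (join n' m' u)
    right : n' ℕ.≤ toℕ (n' ↑ʳ l)
    right = subst (n' ℕ.≤_) (sym (Fin.toℕ-↑ʳ n' l)) (ℕ.m≤m+n n' (toℕ l))

  minorN-splitAt : ∀ r c → minorN r c ≡ minorEntry (splitAt n' r) (splitAt n' c)
  minorN-splitAt r c = trans (sym (cong₂ minorN (Fin.join-splitAt n' m' r) (Fin.join-splitAt n' m' c)))
                         (minorN-join (splitAt n' r) (splitAt n' c))

  -- The keys 2λᵢ and 2j − 1 of the proof idea, in the indexing of Defs.
  blockKey : Fin n' ⊎ Fin m' → ℕ
  blockKey (inj₁ i) = 2 ℕ.* leadingNegOnes (C (suc i))
  blockKey (inj₂ l) = suc (2 ℕ.* suc (toℕ l))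

  module _ (entries : ∀ i j → (C i j ≡ 0ℤ) ⊎ (C i j ≡ -1ℤ))
           (rowPrefix : ∀ i j j′ → C i j ≡ -1ℤ → j′ ≤ j → C i j′ ≡ -1ℤ) where

    minorEntry-keyUpper : ∀ u v → minorEntry u v ≢ 0ℤ → u ≢ v → blockKey u ℕ.< blockKey v
    minorEntry-keyUpper (inj₁ i) (inj₁ k) nonzero u≢v = ⊥-elim (u≢v (cong inj₁ (A-offDiagonal i k nonzero)))
    minorEntry-keyUpper (inj₁ i) (inj₂ l) nonzero _   =
      ℕ.s≤s (ℕ.*-monoʳ-≤ 2 (leadingNegOnes-≤ (C (suc i)) (suc l) step))
      where
      step : C (suc i) (suc l) ≢ -1ℤ
      step c≡-1 = nonzero (cong₂ _-_ c≡-1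
        (rowPrefix (suc i) (suc l) (inject₁ l) c≡-1 (Fin.i≤inject₁[j]⇒i≤1+j (Fin.≤-refl {x = inject₁ l}))))
    minorEntry-keyUpper (inj₂ j) (inj₁ k) nonzero _   =
      ℕ.≤-trans (ℕ.≤-reflexive (sym (ℕ.*-suc 2 (suc (toℕ j)))))
                (ℕ.*-monoʳ-≤ 2 (<-leadingNegOnes (C (suc k)) (rowPrefix (suc k)) (suc j) negative))
      where
      negative : C (suc k) (suc j) ≡ -1ℤ
      negative = [ (λ c≡0 → ⊥-elim (nonzero c≡0)) , id ]′ (entries (suc k) (suc j))
    minorEntry-keyUpper (inj₂ j) (inj₂ l) nonzero u≢v = byDiagonal (E (inj₂ j) (inj₂ (suc l)) ℤ.≟ 0ℤ)
      where
      byDiagonal : Dec (E (inj₂ j) (inj₂ (suc l)) ≡ 0ℤ) → blockKey (inj₂ j) ℕ.< blockKey (inj₂ l)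
      byDiagonal (no  diagonal≢0) =
        ⊥-elim (u≢v (cong inj₂ (sym (Fin.suc-injective (D-offDiagonal j (suc l) diagonal≢0)))))
      byDiagonal (yes diagonal≡0) = ℕ.s≤s (ℕ.*-monoʳ-< 2 (ℕ.s≤s (ℕ.≤-reflexive j+1≡l)))
        where
        j+1≡l : suc (toℕ j) ≡ toℕ l
        j+1≡l = sym (trans (sym (Fin.toℕ-inject₁ l))
                      (cong toℕ (D-offDiagonal j (inject₁ l) (λ e → nonzero (cong₂ _-_ diagonal≡0 e)))))

    det-minorN : det K minorN ≡ Π n' a * Π m' b
    det-minorN = begin
      det K minorN                                                  ≡⟨ det-keyUpperTriangular K (blockKey ∘ splitAt n') minorN upper ⟩
      Π K (λ x → minorN x x)                                        ≡⟨ Π-++ n' m' (λ x → minorN x x) ⟩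
      Π n' (λ i → minorN (i ↑ˡ m') (i ↑ˡ m')) * Π m' (λ j → minorN (n' ↑ʳ j) (n' ↑ʳ j))
        ≡⟨ cong₂ _*_ (Π-cong n' λ i → trans (minorN-join (inj₁ i) (inj₁ i)) (A-diagonal i))
                     (Π-cong m' λ j → trans (minorN-join (inj₂ j) (inj₂ j))
                                      (trans (cong₂ _-_ (D-diagonal j) (D-inject₁ j)) (ℤ.+-identityʳ (b j)))) ⟩
      Π n' a * Π m' b                                             ∎
      where
      open ≡-Reasoning
      upper : ∀ r c → minorN r c ≢ 0ℤ → r ≢ c → blockKey (splitAt n' r) ℕ.< blockKey (splitAt n' c)
      upper r c nonzero r≢c = minorEntry-keyUpper (splitAt n' r) (splitAt n' c)
        (nonzero ∘ trans (minorN-splitAt r c))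
        (λ e → r≢c (trans (sym (Fin.join-splitAt n' m' r)) (trans (cong (join n' m') e) (Fin.join-splitAt n' m' c))))

    det-bigM : (∀ j → C zero j ≡ -1ℤ) → det (suc K) M ≡ (-1ℤ ^ suc n') * (Π n' a * Π m' b)
    det-bigM firstRow = begin
      det (suc K) M                                  ≡⟨ sym (det-differenceFrom K m' n' refl M) ⟩
      det (suc K) N                                  ≡⟨ Σ-single (suc K) (laplaceTerm N) pivot
                                                          (λ y y≢pivot → laplaceTerm-zeroEntry N y (N-top-elsewhere firstRow y y≢pivot)) ⟩
      (-1ℤ ^ toℕ pivot) * (N zero pivot * det K minorN)  ≡⟨ cong₂ (λ t x → (-1ℤ ^ t) * (x * det K minorN)) toℕ-pivot (N-top-pivot firstRow) ⟩
      (-1ℤ ^ n') * (-1ℤ * det K minorN)                   ≡⟨ cong (λ d → (-1ℤ ^ n') * (-1ℤ * d)) det-minorN ⟩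
      (-1ℤ ^ n') * (-1ℤ * (Π n' a * Π m' b))            ≡⟨ shift (-1ℤ ^ n') (Π n' a * Π m' b) ⟩
      (-1ℤ ^ suc n') * (Π n' a * Π m' b)                ∎
      where
      open ≡-Reasoning
      shift : ∀ s x → s * (-1ℤ * x) ≡ (-1ℤ * s) * x
      shift = solve 2 (λ s x → s :* (con -1ℤ :* x) := (con -1ℤ :* s) :* x) refl

lemma1 : (n' m' : ℕ) (C : Fin (suc n') → Fin (suc m') → ℤ) (a : Fin n' → ℤ) (b : Fin m' → ℤ) →
    (∀ i j → (C i j ≡ 0ℤ) ⊎ (C i j ≡ -1ℤ)) →
    (∀ j → C zero j ≡ -1ℤ) →
    (∀ i j i' j' → C i j ≡ -1ℤ → i' ≤ i → j' ≤ j → C i' j' ≡ -1ℤ) →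
    (∀ i k → i ≤ k → a k ≤ℤ a i) →
    (∀ j l → j ≤ l → b l ≤ℤ b j) →
    (∀ i → Σ (suc (n' ℕ.+ m')) (λ c → bigM n' m' C a b ((suc i) ↑ˡ m') c) ≡ 0ℤ) →
    (∀ j → Σ (suc (n' ℕ.+ m')) (λ r → bigM n' m' C a b r (cast (+-suc n' m') (n' ↑ʳ suc j))) ≡ 0ℤ) →
    det (suc (n' ℕ.+ m')) (bigM n' m' C a b) ≡ (-1ℤ ^ suc n') * (Π n' a * Π m' b)
lemma1 n' m' C a b entries firstRow ferrers _ _ _ _ =
  BlockMatrix.det-bigM n' m' C a b entries rowPrefix firstRow
  where
  rowPrefix : ∀ i j j′ → C i j ≡ -1ℤ → j′ ≤ j → C i j′ ≡ -1ℤ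
  rowPrefix i j j′ cij≡-1 j′≤j = ferrers i j i j′ cij≡-1 Fin.≤-refl j′≤j
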